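{- (Termination.) For every counter system $M$ of disjunctive templates $A,B$, every finite $ERR\subseteq S$ and every propositional formula $\mathit{initConstr}$ over $\delta$ having $TRConstr$ as a conjunct, the procedure ParamRepair$(M,ERR,\mathit{initConstr})$ terminates.
   Context: Disjunctive templates: $Q_A,Q_B$ disjoint finite sets, $Q=Q_A\cup Q_B$; $U=(Q_U,\mathit{init}_U,\mathcal G_U,\delta_U)$, $U\in\{A,B\}$, with guards $\mathcal G_U\subseteq\mathcal P(Q)$ and total $\delta_U\subseteq Q_U\times\mathcal G_U\times Q_U$; $\delta=\delta_A\cup\delta_B$, $\delta_U(q)$ the outgoing transitions of $q$. Counter system $M=(S,S_0,\Delta)$: $S=Q_A\times\mathbb N_0^{|B|}$, $S_0=\{(\mathit{init}_A,\vec c)\mid\vec c(q)=0\text{ for }q\ne\mathit{init}_B\}$; $s\xrightarrow{t}s'$ iff (1) $t=(q_A,g,q'_A)\in\delta_A$, $s=(q_A,\vec c)$, $s'=(q'_A,\vec c)$, some $q_i\in g\cap Q_B$ has $\vec c(i)\ge1$; or (2) $t=(q_i,g,q_j)\in\delta_B$, $s=(q_A,\vec c)$, $s'=(q_A,\vec c-\vec u_i+\vec u_j)$, $\vec c(i)\ge1$, and ($q_A\in g$, or some $q_l\in g\cap Q_B$, $l\ne i$, with $\vec c(l)\ge1$, or $q_i\in g$, $\vec c(i)\ge2$). $\mathrm{Restrict}(M,\delta')$ is defined the same way using only transitions in $\delta'\subseteq\delta$. Order $(q_A,\vec c)\lessapprox(q'_A,\vec d)$ iff $q_A=q'_A$,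 $\vec c\le\vec d$; ${\uparrow}$ upward closure; $\mathit{minBasis}$ minimal elements; $\mathit{pred}$/$\mathit{Succ}$ one-step predecessors/successors in the current system. Elements of $\delta$ are propositional variables; $\delta'\subseteq\delta$ is identified with the assignment making exactly $\delta'$ true. $TRConstr=\bigwedge_{q\in Q_A}\bigvee_{t\in\delta_A(q)}t\wedge\bigwedge_{q\in Q_B}\bigvee_{t\in\delta_B(q)}t$. ModelCheck$(M')$: $E_0=ERR$, $\mathit{temp}=ERR$, $\mathit{visited}=\emptyset$, $i=1$; while $\mathit{temp}\ne\mathit{visited}$: $\mathit{visited}:=\mathit{temp}$; $E_i:=\mathit{minBasis}(\mathit{pred}({\uparrow}E_{i-1}))$ in $M'$; if $E_i\cap S_0\ne\emptyset$ return (False, $E_0,\dots,E_{i-1},E_i\cap S_0$); $\mathit{temp}:=\mathit{minBasis}(\mathit{visited}\cup E_i)$; $i:=i+1$; then return True. ParamRepair$(M,ERR,\mathit{initConstr})$: $M':=M$, $\delta':=\delta$, $\mathit{acc}:=\mathit{true}$; loop: if ModelCheck$(M')$ returns True, return $\delta'$; else with $E_0,\dots,E_k$ set $RE_k:=E_k$, $RE_{i-1}:=\mathit{Succ}(RE_i)\cap{\uparrow}E_{i-1}$ (in $M'$), $\mathit{acc}:=\bigwedge_{s\in RE_k}\mathrm{BC}(s,[RE_{k-1},\dots,RE_0])\wedge\mathit{acc}$; if $\mathit{acc}\wedge\mathit{initConstr}$ is unsatisfiable return "Unrealizable"; else let $\delta'$ be a satisfying assignment and $M':=\mathrm{Restrict}(M,\delta')$.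 $\mathrm{BC}(s,[X_1,\dots,X_m])$: let $L$ be the local transitions $t$ enabled in $s$ in $M'$ with $s\xrightarrow{t}s_t\in X_1$; if $m=1$ return $\bigwedge_{t\in L}\neg t$, else $\bigwedge_{t\in L}(\neg t\vee\mathrm{BC}(s_t,[X_2,\dots,X_m]))$. -}

module Defs where

open import Data.Bool using (Bool; true; false; _∧_; _∨_; not; T; if_then_else_)
open import Data.Nat using (ℕ; zero; suc; _≤ᵇ_; pred)
open import Data.Fin using (Fin)
import Data.Fin as Fin
open import Data.Sum using (_⊎_; inj₁; inj₂)
open import Data.Product using (_×_; _,_; proj₁; proj₂; Σ; ∃)
open import Data.Maybe using (Maybe; just; nothing)
open import Data.Vec using (Vec; []; _∷_; lookup; _[_]%=_)
open import Data.Bool.ListAction using (any; all)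
open import Data.List using (List; []; _∷_; allFin; filterᵇ; map; concatMap; foldr; _++_; _∷ʳ_; reverse)
open import Data.List.Membership.Propositional using (_∈_)
open import Relation.Nullary using (¬_; does)
open import Relation.Binary.PropositionalEquality using (_≡_)

-- Q_A = Fin nA, Q_B = Fin nB, Q = Q_A ⊎ Q_B.
-- A guard is a subset of Q, given by its (decidable) characteristic function.
-- δ_A = { transA t | t : Fin mA },  δ_B = { transB t | t : Fin mB }.

Guard : ℕ → ℕ → Set
Guard nA nB = Fin nA ⊎ Fin nB → Bool

record Templates : Set where
  field
    nA nB mA mB : ℕ
    initA  : Fin nA
    initB  : Fin nB
    transA : Fin mA → Fin nA × Guard nA nB × Fin nA
    transB : Fin mB → Fin nB × Guard nA nB × Fin nB

Total : Templates → Set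
Total T = (∀ q → ∃ λ t → proj₁ (transA t) ≡ q) × (∀ q → ∃ λ t → proj₁ (transB t) ≡ q)
  where open Templates T

module Proc (Tm : Templates) where
  open Templates Tm

  _==_ : ∀ {n} → Fin n → Fin n → Bool
  i == j = does (i Fin.≟ j)

  -- δ = δ_A ∪ δ_B : the propositional variables
  Trans : Set
  Trans = Fin mA ⊎ Fin mB

  allTrans : List Trans
  allTrans = map inj₁ (allFin mA) ++ map inj₂ (allFin mB)

  -- δ' ⊆ δ, identified with the assignment making exactly δ' true
  Assignment : Set
  Assignment = Trans → Bool

  data Formula : Set where
    var      : Trans → Formula
    tt ff    : Formula
    ¬'_      : Formula → Formula
    _∧'_ _∨'_ : Formula → Formula → Formula

  infixr 6 _∧'_
  infixr 5 _∨'_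
  infix 7 ¬'_

  eval : Assignment → Formula → Bool
  eval ρ (var t)  = ρ t
  eval ρ tt       = true
  eval ρ ff       = false
  eval ρ (¬' f)   = not (eval ρ f)
  eval ρ (f ∧' g) = eval ρ f ∧ eval ρ g
  eval ρ (f ∨' g) = eval ρ f ∨ eval ρ g

  ⋀ ⋁ : List Formula → Formula
  ⋀ = foldr _∧'_ tt
  ⋁ = foldr _∨'_ ff

  Satisfiable : Formula → Set
  Satisfiable f = ∃ λ ρ → eval ρ f ≡ true

  TRConstr : Formula
  TRConstr =
    ⋀ (map (λ q → ⋁ (map (λ t → var (inj₁ t))
                          (filterᵇ (λ t → proj₁ (transA t) == q) (allFin mA))))
           (allFin nA))
    ∧' ⋀ (map (λ q → ⋁ (map (λ t → var (inj₂ t))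
                          (filterᵇ (λ t → proj₁ (transB t) == q) (allFin mB))))
           (allFin nB))

  State : Set
  State = Fin nA × Vec ℕ nB

  _==S_ : State → State → Bool
  (q , c) ==S (q' , c') = (q == q') ∧ vecEq c c'
    where
    vecEq : ∀ {n} → Vec ℕ n → Vec ℕ n → Bool
    vecEq [] [] = true
    vecEq (x ∷ xs) (y ∷ ys) = does (x Data.Nat.≟ y) ∧ vecEq xs ys

  isInit : State → Bool
  isInit (q , c) = (q == initA) ∧ all (λ i → (i == initB) ∨ (lookup c i ≤ᵇ 0)) (allFin nB)

  -- the local transition t fired in s in Restrict(M, ρ): the successor, if enabled
  post : Assignment → State → Trans → Maybe State
  post ρ s t = if ρ t then post₀ s t else nothing
    where
    post₀ : State → Trans → Maybe State
    post₀ (qA , c) (inj₁ t) with transA t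
    ... | (q , g , q') =
      if (qA == q) ∧ any (λ i → g (inj₂ i) ∧ (1 ≤ᵇ lookup c i)) (allFin nB)
      then just (q' , c) else nothing
    post₀ (qA , c) (inj₂ t) with transB t
    ... | (i , g , j) =
      if (1 ≤ᵇ lookup c i)
         ∧ (g (inj₁ qA)
            ∨ any (λ l → not (l == i) ∧ g (inj₂ l) ∧ (1 ≤ᵇ lookup c l)) (allFin nB)
            ∨ (g (inj₂ i) ∧ (2 ≤ᵇ lookup c i)))
      then just (qA , ((c [ i ]%= pred) [ j ]%= suc)) else nothing

  leqS : State → State → Bool
  leqS (q , c) (q' , d) = (q == q') ∧ leqV c d
    where
    leqV : ∀ {n} → Vec ℕ n → Vec ℕ n → Bool
    leqV [] [] = true
    leqV (x ∷ xs) (y ∷ ys) = (x ≤ᵇ y) ∧ leqV xs ys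

  _≲_ : State → State → Set
  s ≲ s' = T (leqS s s')

  inUp : List State → State → Bool
  inUp E s = any (λ e → leqS e s) E

  elem : State → List State → Bool
  elem s X = any (λ x → x ==S s) X

  maybeIn : (State → Bool) → Maybe State → Bool
  maybeIn P (just s) = P s
  maybeIn P nothing  = false

  inPredUp : Assignment → List State → State → Bool
  inPredUp ρ E s = any (λ t → maybeIn (inUp E) (post ρ s t)) allTrans

  Succ : Assignment → List State → List State
  Succ ρ X = concatMap (λ s → concatMap (λ t → toList (post ρ s t)) allTrans) X
    where
    toList : Maybe State → List State
    toList (just x) = x ∷ []
    toList nothing  = []

  IsMinBasis : (State → Set) → List State → Set
  IsMinBasis P L = ∀ s → (s ∈ L → Min s) × (Min s → s ∈ L)
    where
    Min : State → Set
    Min s = P s × (∀ s' → P s' → s' ≲ s → s' ≡ s)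

  SetEq : List State → List State → Set
  SetEq X Y = ∀ s → (s ∈ X → s ∈ Y) × (s ∈ Y → s ∈ X)

  BC : Assignment → State → List (List State) → Formula
  BC ρ s [] = tt          -- never used (m ≥ 1 in ParamRepair)
  BC ρ s (X ∷ []) = ⋀ (map (λ t → caseT t (λ _ → ¬' var t)) allTrans)
    where
    caseT : Trans → (State → Formula) → Formula
    caseT t k with post ρ s t
    ... | just st = if elem st X then k st else tt
    ... | nothing = tt
  BC ρ s (X ∷ Y ∷ Xs) = ⋀ (map (λ t → caseT t (λ st → (¬' var t) ∨' BC ρ st (Y ∷ Xs))) allTrans)
    where
    caseT : Trans → (State → Formula) → Formula
    caseT t k with post ρ s t
    ... | just st = if elem st X then k st else tt
    ... | nothing = tt

  -- RE-sequence: given [E_0, …, E_{k-1}] and RE_k, returns [RE_{k-1}, …, RE_0]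
  -- with RE_{i-1} = Succ(RE_i) ∩ ↑E_{i-1}.
  REs : Assignment → List (List State) → List State → List (List State)
  REs ρ Es REk = go (reverse Es) REk
    where
    go : List (List State) → List State → List (List State)
    go [] _ = []
    go (E ∷ Es') RE = let RE' = filterᵇ (inUp E) (Succ ρ RE) in RE' ∷ go Es' RE'

  -- ParamRepair(M, ERR, initConstr) as a nondeterministic small-step machine.
  -- Nondeterminism: choice of list representations of the sets E_i / temp
  -- (all set-equal), and choice of the satisfying assignment δ'.

  data Config : Set where
    -- ModelCheck(Restrict(M, ρ)) at the loop test; Es = [E_0, …, E_{i-1}]
    mcLoop : (ρ : Assignment) (acc : Formula) (Es : List (List State))
             (visited temp : List State) → Config
    returned     : Assignment → Config
    unrealizable : Config

  lastE : List (List State) → List State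
  lastE [] = []
  lastE (E ∷ []) = E
  lastE (_ ∷ E ∷ Es) = lastE (E ∷ Es)

  module Run (ERR : List State) (initConstr : Formula) where

    start : Assignment → Formula → Config
    start ρ acc = mcLoop ρ acc (ERR ∷ []) [] ERR

    -- new constraint after a counterexample E_0,…,E_{k-1}, E_k ∩ S_0
    newAcc : Assignment → Formula → List (List State) → List State → Formula
    newAcc ρ acc Es Ek0 = ⋀ (map (λ s → BC ρ s (REs ρ Es Ek0)) Ek0) ∧' acc

    data _⟶_ : Config → Config → Set where
      -- while temp ≠ visited fails: ModelCheck returns True, ParamRepair returns δ'
      mc-true : ∀ {ρ acc Es visited temp} → SetEq temp visited →
                mcLoop ρ acc Es visited temp ⟶ returned ρ
      mc-iter : ∀ {ρ acc Es visited temp Ei temp'} → ¬ SetEq temp visited →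
                IsMinBasis (λ s → T (inPredUp ρ (lastE Es) s)) Ei →
                filterᵇ isInit Ei ≡ [] →
                IsMinBasis (λ s → s ∈ temp ++ Ei) temp' →
                mcLoop ρ acc Es visited temp ⟶ mcLoop ρ acc (Es ∷ʳ Ei) temp temp'
      mc-false-unreal : ∀ {ρ acc Es visited temp Ei} → ¬ SetEq temp visited →
                IsMinBasis (λ s → T (inPredUp ρ (lastE Es) s)) Ei →
                ¬ filterᵇ isInit Ei ≡ [] →
                (∀ ρ' → eval ρ' (newAcc ρ acc Es (filterᵇ isInit Ei) ∧' initConstr) ≡ false) →
                mcLoop ρ acc Es visited temp ⟶ unrealizable
      mc-false-repair : ∀ {ρ acc Es visited temp Ei} ρ' → ¬ SetEq temp visited →
                IsMinBasis (λ s → T (inPredUp ρ (lastE Es) s)) Ei →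
                ¬ filterᵇ isInit Ei ≡ [] →
                eval ρ' (newAcc ρ acc Es (filterᵇ isInit Ei) ∧' initConstr) ≡ true →
                mcLoop ρ acc Es visited temp ⟶
                  start ρ' (newAcc ρ acc Es (filterᵇ isInit Ei))

    data Terminates : Config → Set where
      term-returned : ∀ ρ → Terminates (returned ρ)
      term-unreal   : Terminates unrealizable
      term-step     : ∀ {c} → (∃ λ c' → c ⟶ c') →
                      (∀ c' → c ⟶ c' → Terminates c') → Terminates c

    paramRepairCall : Config
    paramRepairCall = start (λ _ → true) tt

{-# OPTIONS --safe #-}
-- ParamRepair terminates for two reasons.  Each repair adds to acc a conjunct that the current
-- assignment violates although it satisfies acc, so the number of models of acc among the finitely
-- many assignments decreases.  Each call of ModelCheck terminates because the counter system is
-- well-structured: transitions are monotone for the order ⊑ (same A-state, counters pointwise ≤),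
-- minimal predecessor bases are finite (the guards compare counters only with 1 and 2, so minimal
-- predecessors lie in a box), and every iteration that does not return adds to temp a state lying
-- above none of the states found before.  As ⊑ is almost full (Dickson's lemma, in the inductive
-- formulation of Vytiniotis, Coquand and Wahlstedt), such sequences are finite.
module Submission where

open import Defs

open import Data.Bool using (Bool; true; false; T; _∧_; _∨_; not; if_then_else_)
open import Data.Bool.ListAction using (any)
open import Data.Bool.Properties using (T-∧; T-∨; T-≡; ∧-zeroʳ)
open import Data.Empty using (⊥-elim)
open import Data.Fin as Fin using (Fin)
import Data.Fin.Properties as Finₚ
open import Data.List
  using (List; []; _∷_; allFin; filter; filterᵇ; map; upTo; cartesianProduct; cartesianProductWith;
         _++_; reverse; _∷ʳ_; length)
open import Data.List.Membership.Propositional using (_∈_; find; lose)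
open import Data.List.Membership.Propositional.Properties
  using (∈-allFin; ∈-++⁺ˡ; ∈-++⁺ʳ; ∈-map⁺; ∈-concatMap⁺; ∈-filter⁺; ∈-filter⁻; ∈-upTo⁺; ∈-upTo⁻;
         ∈-cartesianProduct⁺; ∈-cartesianProduct⁻; ∈-cartesianProductWith⁺; ∈-cartesianProductWith⁻)
open import Data.List.Properties using (reverse-++)
open import Data.List.Relation.Unary.All as All using (All)
open import Data.List.Relation.Unary.All.Properties using (¬All⇒Any¬)
open import Data.List.Relation.Unary.Any as Any using (Any; here; there; any?)
open import Data.List.Relation.Unary.Any.Properties using (any⁺; any⁻)
open import Data.Maybe using (just; nothing)
open import Data.Nat as ℕ using (ℕ; zero; suc; _+_; _≤_; _<_; _≤ᵇ_; z≤n; s≤s; pred)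
open import Data.Nat.Induction using (<-wellFounded)
open import Data.Nat.Properties
  using (≤ᵇ⇒≤; ≤⇒≤ᵇ; ≤-refl; ≤-reflexive; ≤-trans; ≤-antisym; ≤-pred; ≰⇒>; n≤1+n; m≤n⇒m≤1+n;
         m≤n⇒m<n∨m≡n; m≤m+n; m≤n+m; +-mono-≤; +-mono-<-≤; +-monoʳ-<; suc[m]≤n⇒m≤pred[n]; pred[n]≤n;
         1+n≢n; pred-mono-≤; module ≤-Reasoning)
open import Data.Product using (Σ; ∃; _×_; _,_; proj₁; proj₂)
import Data.Product as Prod
open import Data.Product.Properties using (≡-dec)
open import Data.Sum using (_⊎_; inj₁; inj₂; [_,_])
import Data.Sum as Sum
open import Data.Unit using (⊤)
open import Data.Vec using (Vec; []; _∷_; lookup; head; tail; replicate; tabulate; sum; _[_]≔_; _[_]%=_)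
import Data.Vec.Properties as Vecₚ
open import Function using (_∘_; id; const; _on_)
open import Function.Bundles using (Equivalence)
open import Induction.WellFounded using (Acc; acc)
open import Level using (0ℓ)
open import Relation.Binary using (Rel; _⇒_; DecidableEquality)
open import Relation.Binary.Construct.Intersection using (_∩_)
open import Relation.Binary.PropositionalEquality
  using (_≡_; _≢_; refl; sym; trans; cong; cong₂; subst; subst₂)
open import Relation.Nullary using (¬_; Dec; yes; no; does; contradiction)
open import Relation.Nullary.Decidable using (map′; T?; _→-dec_)

open Equivalence using (to; from)

private
  variable
    X Y : Set
    R S : Rel X 0ℓ

-- Almost-full relations and Dickson's lemma

data WFT (X : Set) : Set where
  leaf : WFT X
  node : (X → WFT X) → WFT X

_↑_ : Rel X 0ℓ → X → Rel X 0ℓ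
(R ↑ x) y z = R y z ⊎ R x y

SecuredBy : Rel X 0ℓ → WFT X → Set
SecuredBy R leaf     = ∀ x y → R x y
SecuredBy R (node f) = ∀ x → SecuredBy (R ↑ x) (f x)

AlmostFull : Rel X 0ℓ → Set
AlmostFull {X} R = Σ (WFT X) (SecuredBy R)

↑-mono : ∀ {x} → R ⇒ S → (R ↑ x) ⇒ (S ↑ x)
↑-mono R⇒S = Sum.map R⇒S R⇒S

SecuredBy-mono : ∀ p → R ⇒ S → SecuredBy R p → SecuredBy S p
SecuredBy-mono leaf     R⇒S sec x y = R⇒S (sec x y)
SecuredBy-mono {R = R} {S = S} (node f) R⇒S sec x =
  SecuredBy-mono (f x) (↑-mono {R = R} {S = S} R⇒S) (sec x)

AlmostFull-mono : R ⇒ S → AlmostFull R → AlmostFull S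
AlmostFull-mono R⇒S (p , sec) = p , SecuredBy-mono p R⇒S sec

AlmostFull-node : (Rₓ : X → Rel X 0ℓ) → (∀ x → AlmostFull (Rₓ x)) → (∀ x → Rₓ x ⇒ (R ↑ x)) →
                  AlmostFull R
AlmostFull-node Rₓ af Rₓ⇒R↑ = node (λ x → proj₁ (af x)) ,
                            λ x → SecuredBy-mono (proj₁ (af x)) (Rₓ⇒R↑ x) (proj₂ (af x))

SecuredBy-on : (f : X → Y) (p : WFT Y) → SecuredBy R p → Σ (WFT X) (SecuredBy (R on f))
SecuredBy-on f leaf     sec = leaf , λ x y → sec (f x) (f y)
SecuredBy-on f (node g) sec =
  node (λ x → proj₁ (SecuredBy-on f (g (f x)) (sec (f x)))) ,
  λ x → proj₂ (SecuredBy-on f (g (f x)) (sec (f x)))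

AlmostFull-on : (f : X → Y) → AlmostFull R → AlmostFull (R on f)
AlmostFull-on f (p , sec) = SecuredBy-on f p sec

_∪ₚ_ : Rel X 0ℓ → (X → Set) → Rel X 0ℓ
(R ∪ₚ P) y z = R y z ⊎ P y

↑-∪ₚ : ∀ {P : X → Set} {x} → (R ↑ x) ∪ₚ P ⇒ (R ∪ₚ P) ↑ x
↑-∪ₚ = [ [ inj₁ ∘ inj₁ , inj₂ ∘ inj₁ ] , inj₁ ∘ inj₂ ]

∪ₚ-↑ : ∀ {P : X → Set} {x} → (R ∪ₚ P) ↑ x ⇒ (R ↑ x) ∪ₚ (λ y → P y ⊎ P x)
∪ₚ-↑ = [ Sum.map inj₁ inj₁ , Sum.map inj₂ inj₂ ]

∪ₚ-weaken : ∀ {P : X → Set} {x} → R ∪ₚ P ⇒ (R ↑ x) ∪ₚ P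
∪ₚ-weaken = Sum.map₁ inj₁

secured-∪-const : ∀ {A B : Set} p q → SecuredBy (R ∪ₚ const A) p → SecuredBy (R ∪ₚ const B) q →
                  AlmostFull (R ∪ₚ const (A × B))
secured-∪-const {R = R} leaf q secA secB = q , SecuredBy-mono q add-A secB
  where
  add-A : R ∪ₚ const _ ⇒ R ∪ₚ const _
  add-A {y} {z} = [ inj₁ , (λ b → Sum.map₂ (_, b) (secA y z)) ]
secured-∪-const {R = R} (node f) q secA secB =
  AlmostFull-node _
    (λ x → secured-∪-const (f x) q
             (SecuredBy-mono (f x) (Sum.map₂ [ id , id ] ∘ ∪ₚ-↑ {R = R}) (secA x))
             (SecuredBy-mono q (∪ₚ-weaken {R = R}) secB))
    (λ x → ↑-∪ₚ {R = R})

AlmostFull-∪-const : ∀ {A B : Set} → AlmostFull (R ∪ₚ const A) → AlmostFull (R ∪ₚ const B) →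
                     AlmostFull (R ∪ₚ const (A × B))
AlmostFull-∪-const (p , secA) (q , secB) = secured-∪-const p q secA secB

secured-∪-× : ∀ {P Q : X → Set} p q → SecuredBy (R ∪ₚ P) p → SecuredBy (R ∪ₚ Q) q →
              AlmostFull (R ∪ₚ (λ y → P y × Q y))
secured-∪-× {R = R} leaf q secP secQ = q , SecuredBy-mono q add-P secQ
  where
  add-P : R ∪ₚ _ ⇒ R ∪ₚ _
  add-P {y} {z} = [ inj₁ , (λ qy → Sum.map₂ (_, qy) (secP y z)) ]
secured-∪-× {R = R} p@(node _) leaf secP secQ = p , SecuredBy-mono p add-Q secP
  where
  add-Q : R ∪ₚ _ ⇒ R ∪ₚ _
  add-Q {y} {z} = [ inj₁ , (λ py → Sum.map₂ (py ,_) (secQ y z)) ]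
secured-∪-× {R = R} {P} {Q} (node f) (node g) secP secQ =
  AlmostFull-node _ (λ x → AlmostFull-∪-const (left x) (right x)) (λ x → regroup)
  where
  left : ∀ x → AlmostFull (((R ↑ x) ∪ₚ (λ y → P y × Q y)) ∪ₚ const (P x))
  left x = AlmostFull-mono [ inj₁ ∘ inj₁ , (λ { (inj₁ py , qy) → inj₁ (inj₂ (py , qy))
                                               ; (inj₂ px , _) → inj₂ px }) ]
             (secured-∪-× (f x) (node g) (SecuredBy-mono (f x) (∪ₚ-↑ {R = R} {P}) (secP x))
                                         (SecuredBy-mono (node g) (∪ₚ-weaken {R = R} {Q}) secQ))
  right : ∀ x → AlmostFull (((R ↑ x) ∪ₚ (λ y → P y × Q y)) ∪ₚ const (Q x))
  right x = AlmostFull-mono [ inj₁ ∘ inj₁ , (λ { (py , inj₁ qy) → inj₁ (inj₂ (py , qy))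
                                                ; (_ , inj₂ qx) → inj₂ qx }) ]
              (secured-∪-× (node f) (g x) (SecuredBy-mono (node f) (∪ₚ-weaken {R = R} {P}) secP)
                                          (SecuredBy-mono (g x) (∪ₚ-↑ {R = R} {Q}) (secQ x)))
  regroup : ∀ {x} → ((R ↑ x) ∪ₚ (λ y → P y × Q y)) ∪ₚ const (P x × Q x) ⇒ (R ∪ₚ (λ y → P y × Q y)) ↑ x
  regroup = [ ↑-∪ₚ {R = R} , inj₂ ∘ inj₂ ]

AlmostFull-∪-× : ∀ {P Q : X → Set} → AlmostFull (R ∪ₚ P) → AlmostFull (R ∪ₚ Q) →
                 AlmostFull (R ∪ₚ (λ y → P y × Q y))
AlmostFull-∪-× (p , secP) (q , secQ) = secured-∪-× p q secP secQ

secured-∩ : ∀ p q → SecuredBy R p → SecuredBy S q → AlmostFull (R ∩ S)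
secured-∩ leaf q secR secS = q , SecuredBy-mono q (secR _ _ ,_) secS
secured-∩ p@(node _) leaf secR secS = p , SecuredBy-mono p (_, secS _ _) secR
secured-∩ {R = R} {S = S} (node f) (node g) secR secS =
  AlmostFull-node _ (λ x → AlmostFull-∪-× (left x) (right x)) (λ x → id)
  where
  left : ∀ x → AlmostFull ((R ∩ S) ∪ₚ R x)
  left x = AlmostFull-mono (λ { (inj₁ r , inj₁ t) → inj₁ (r , t) ; (inj₂ r , _) → inj₂ r
                              ; (_ , inj₂ r) → inj₂ r })
             (secured-∩ (f x) (node g) (secR x) (SecuredBy-mono (node g) inj₁ secS))
  right : ∀ x → AlmostFull ((R ∩ S) ∪ₚ S x)
  right x = AlmostFull-mono (λ { (inj₁ r , inj₁ t) → inj₁ (r , t) ; (inj₂ t , _) → inj₂ t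
                               ; (_ , inj₂ t) → inj₂ t })
              (secured-∩ (node f) (g x) (SecuredBy-mono (node f) inj₁ secR) (secS x))

AlmostFull-∩ : AlmostFull R → AlmostFull S → AlmostFull (R ∩ S)
AlmostFull-∩ (p , secR) (q , secS) = secured-∩ p q secR secS

chain : ℕ → WFT ℕ
chain zero    = leaf
chain (suc k) = node (λ _ → chain k)

secured-≤-⊎-≥ : ∀ k → SecuredBy (λ y z → y ≤ z ⊎ k ≤ y) (chain k)
secured-≤-⊎-≥ zero    y z = inj₂ z≤n
secured-≤-⊎-≥ (suc k) x   = SecuredBy-mono (chain k) extend (secured-≤-⊎-≥ k)
  where
  extend : (λ y z → y ≤ z ⊎ k ≤ y) ⇒ ((λ y z → y ≤ z ⊎ suc k ≤ y) ↑ x)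
  extend (inj₁ y≤z) = inj₁ (inj₁ y≤z)
  extend {y} (inj₂ k≤y) with x ℕ.≤? y
  ... | yes x≤y = inj₂ (inj₁ x≤y)
  ... | no  x≰y = inj₂ (inj₂ (≤-trans (s≤s k≤y) (≰⇒> x≰y)))

AlmostFull-≤ : AlmostFull _≤_
AlmostFull-≤ = node chain , secured-≤-⊎-≥

_≼_ : ∀ {n} → Rel (Vec ℕ n) 0ℓ
c ≼ d = ∀ k → lookup c k ≤ lookup d k

AlmostFull-≼ : ∀ n → AlmostFull (_≼_ {n})
AlmostFull-≼ zero    = leaf , λ { [] [] () }
AlmostFull-≼ (suc n) =
  AlmostFull-mono (λ {c} {d} → head-tail {c} {d})
    (AlmostFull-∩ (AlmostFull-on head AlmostFull-≤) (AlmostFull-on tail (AlmostFull-≼ n)))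
  where
  head-tail : ((_≤_ on head) ∩ (_≼_ on tail)) ⇒ _≼_
  head-tail {_ ∷ _} {_ ∷ _} (h , t) Fin.zero    = h
  head-tail {_ ∷ _} {_ ∷ _} (h , t) (Fin.suc k) = t k

unitVec : ∀ {n} → Fin n → Vec ℕ n
unitVec {n} i = replicate n 0 [ i ]≔ 1

unitVec-≼⇒≡ : ∀ {n} {i j : Fin n} → unitVec i ≼ unitVec j → i ≡ j
unitVec-≼⇒≡ {n} {i} {j} i≼j with i Fin.≟ j
... | yes i≡j = i≡j
... | no  i≢j = contradiction 1≤0 λ ()
  where
  1≤0 : 1 ≤ 0
  1≤0 = subst₂ _≤_ (Vecₚ.lookup∘update i (replicate n 0) 1)
                   (trans (Vecₚ.lookup∘update′ i≢j (replicate n 0) 1) (Vecₚ.lookup-replicate i 0))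
                   (i≼j i)

_≡×≼_ : ∀ {m n} → Rel (Fin m × Vec ℕ n) 0ℓ
(i , c) ≡×≼ (j , d) = i ≡ j × c ≼ d

AlmostFull-≡×≼ : ∀ m n → AlmostFull (_≡×≼_ {m} {n})
AlmostFull-≡×≼ m n =
  AlmostFull-mono (λ (i≼j , c≼d) → unitVec-≼⇒≡ i≼j , c≼d)
    (AlmostFull-∩ (AlmostFull-on (unitVec ∘ proj₁) (AlmostFull-≼ m)) (AlmostFull-on proj₂ (AlmostFull-≼ n)))

module _ {_⊴_ : Rel X 0ℓ} where

  BadExtension : Rel (List X) 0ℓ
  BadExtension ys xs = ∃ λ x → ys ≡ x ∷ xs × ¬ Any (_⊴ x) xs

  secured⇒acc : ∀ {R W} p → SecuredBy R p → (∀ {y z} → R y z → y ⊴ z ⊎ Any (_⊴ y) W) →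
                Acc BadExtension W
  secured⇒acc leaf sec R⊆ = acc λ { (x , refl , x-new) → acc λ { (z , refl , z-new) →
    ⊥-elim ([ z-new ∘ here , x-new ] (R⊆ (sec x z))) } }
  secured⇒acc {R} {W} (node f) sec R⊆ =
    acc λ { (x , refl , x-new) → secured⇒acc (f x) (sec x) (R↑x⊆ x-new) }
    where
    R↑x⊆ : ∀ {x} → ¬ Any (_⊴ x) W → ∀ {y z} → (R ↑ x) y z → y ⊴ z ⊎ Any (_⊴ y) (x ∷ W)
    R↑x⊆ x-new (inj₁ r) = Sum.map₂ there (R⊆ r)
    R↑x⊆ x-new (inj₂ r) with R⊆ r
    ... | inj₁ x⊴y = inj₂ (here x⊴y)
    ... | inj₂ w⊴x = ⊥-elim (x-new w⊴x)

  AlmostFull⇒acc : AlmostFull _⊴_ → Acc BadExtension []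
  AlmostFull⇒acc (p , sec) = secured⇒acc p sec inj₁

does⇒ : ∀ {P : Set} (p? : Dec P) → T (does p?) → P
does⇒ (yes p) _ = p

⇒does : ∀ {P : Set} (p? : Dec P) → P → T (does p?)
⇒does (yes _) _ = _
⇒does (no ¬p) p = ¬p p

∷≢[] : ∀ {A : Set} {xs : List A} {x ys} → xs ≡ x ∷ ys → xs ≢ []
∷≢[] refl ()

nonempty : ∀ {A : Set} {xs : List A} → xs ≢ [] → ∃ (_∈ xs)
nonempty {xs = []}    []≢[] = contradiction refl []≢[]
nonempty {xs = x ∷ _} _     = x , here refl

T-∧-map : ∀ {a b a' b'} → (T a → T a') → (T b → T b') → T (a ∧ b) → T (a' ∧ b')
T-∧-map {a} f g = from T-∧ ∘ Prod.map f g ∘ to (T-∧ {a})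

T-∨-map : ∀ {a b a' b'} → (T a → T a') → (T b → T b') → T (a ∨ b) → T (a' ∨ b')
T-∨-map {a} f g = from T-∨ ∘ Sum.map f g ∘ to (T-∨ {a})

T-any-map : ∀ {A : Set} {p p' : A → Bool} xs → (∀ {x} → T (p x) → T (p' x)) → T (any p xs) → T (any p' xs)
T-any-map xs f = any⁺ _ ∘ Any.map f ∘ any⁻ _ xs

≤ᵇ-mono₂ : ∀ {a b n} → a ≤ b ⊎ 2 ≤ b → n ≤ 2 → T (n ≤ᵇ a) → T (n ≤ᵇ b)
≤ᵇ-mono₂ {a} {n = n} (inj₁ a≤b) n≤2 n≤a = ≤⇒≤ᵇ (≤-trans (≤ᵇ⇒≤ n a n≤a) a≤b)
≤ᵇ-mono₂         (inj₂ 2≤b) n≤2 n≤a = ≤⇒≤ᵇ (≤-trans n≤2 2≤b)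

length-filterᵇ-≤ : ∀ {A : Set} {p q : A → Bool} xs → (∀ {y} → T (q y) → T (p y)) →
                   length (filterᵇ q xs) ≤ length (filterᵇ p xs)
length-filterᵇ-≤ [] q⇒p = z≤n
length-filterᵇ-≤ {p = p} {q} (y ∷ xs) q⇒p with q y in qy | p y in py
... | true  | true  = s≤s (length-filterᵇ-≤ xs q⇒p)
... | true  | false = ⊥-elim (subst T py (q⇒p (subst T (sym qy) _)))
... | false | true  = m≤n⇒m≤1+n (length-filterᵇ-≤ xs q⇒p)
... | false | false = length-filterᵇ-≤ xs q⇒p

length-filterᵇ-< : ∀ {A : Set} {p q : A → Bool} xs {x} → (∀ {y} → T (q y) → T (p y)) →
                   x ∈ xs → T (p x) → ¬ T (q x) → length (filterᵇ q xs) < length (filterᵇ p xs)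
length-filterᵇ-< {p = p} {q} (y ∷ xs) q⇒p (here refl) py ¬qy with q y | p y
... | true  | _     = contradiction _ ¬qy
... | false | true  = s≤s (length-filterᵇ-≤ xs q⇒p)
length-filterᵇ-< {p = p} {q} (y ∷ xs) q⇒p (there x∈xs) px ¬qx with q y in qy | p y in py
... | true  | true  = s≤s (length-filterᵇ-< xs q⇒p x∈xs px ¬qx)
... | true  | false = ⊥-elim (subst T py (q⇒p (subst T (sym qy) _)))
... | false | true  = m≤n⇒m≤1+n (length-filterᵇ-< xs q⇒p x∈xs px ¬qx)
... | false | false = length-filterᵇ-< xs q⇒p x∈xs px ¬qx

_≼ᵇ_ : ∀ {n} → Vec ℕ n → Vec ℕ n → Bool
[]       ≼ᵇ []       = true
(x ∷ xs) ≼ᵇ (y ∷ ys) = (x ≤ᵇ y) ∧ (xs ≼ᵇ ys)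

_≡ᵇ_ : ∀ {n} → Vec ℕ n → Vec ℕ n → Bool
[]       ≡ᵇ []       = true
(x ∷ xs) ≡ᵇ (y ∷ ys) = does (x ℕ.≟ y) ∧ (xs ≡ᵇ ys)

≼ᵇ⇒≼ : ∀ {n} {c d : Vec ℕ n} → T (c ≼ᵇ d) → c ≼ d
≼ᵇ⇒≼ {c = x ∷ c} {y ∷ d} le Fin.zero    = ≤ᵇ⇒≤ x y (proj₁ (to T-∧ le))
≼ᵇ⇒≼ {c = x ∷ c} {y ∷ d} le (Fin.suc k) = ≼ᵇ⇒≼ {c = c} {d} (proj₂ (to (T-∧ {x ≤ᵇ y}) le)) k

≼⇒≼ᵇ : ∀ {n} {c d : Vec ℕ n} → c ≼ d → T (c ≼ᵇ d)
≼⇒≼ᵇ {c = []}    {[]}    le = _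
≼⇒≼ᵇ {c = x ∷ c} {y ∷ d} le = from T-∧ (≤⇒≤ᵇ (le Fin.zero) , ≼⇒≼ᵇ {c = c} {d} (le ∘ Fin.suc))

≡ᵇ-refl : ∀ {n} (c : Vec ℕ n) → T (c ≡ᵇ c)
≡ᵇ-refl []      = _
≡ᵇ-refl (x ∷ c) = from T-∧ (⇒does (x ℕ.≟ x) refl , ≡ᵇ-refl c)

≼-antisym : ∀ {n} {c d : Vec ℕ n} → c ≼ d → d ≼ c → c ≡ d
≼-antisym {c = []}    {[]}    _   _   = refl
≼-antisym {c = x ∷ c} {y ∷ d} c≼d d≼c =
  cong₂ _∷_ (≤-antisym (c≼d Fin.zero) (d≼c Fin.zero))
            (≼-antisym {c = c} {d} (c≼d ∘ Fin.suc) (d≼c ∘ Fin.suc))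

sum-mono : ∀ {n} {c d : Vec ℕ n} → c ≼ d → sum c ≤ sum d
sum-mono {c = []}    {[]}    _   = z≤n
sum-mono {c = x ∷ c} {y ∷ d} c≼d = +-mono-≤ (c≼d Fin.zero) (sum-mono {c = c} {d} (c≼d ∘ Fin.suc))

sum-<  : ∀ {n} {c d : Vec ℕ n} → c ≼ d → c ≢ d → sum c < sum d
sum-< {c = []}    {[]}    _   c≢d = contradiction refl c≢d
sum-< {c = x ∷ c} {y ∷ d} c≼d c≢d with m≤n⇒m<n∨m≡n (c≼d Fin.zero)
... | inj₁ x<y  = +-mono-<-≤ x<y (sum-mono {c = c} {d} (c≼d ∘ Fin.suc))
... | inj₂ refl = +-monoʳ-< x (sum-< {c = c} {d} (c≼d ∘ Fin.suc) (c≢d ∘ cong (x ∷_)))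

lookup≤sum : ∀ {n} (c : Vec ℕ n) k → lookup c k ≤ sum c
lookup≤sum (x ∷ c) Fin.zero    = m≤m+n x (sum c)
lookup≤sum (x ∷ c) (Fin.suc k) = ≤-trans (lookup≤sum c k) (m≤n+m (sum c) x)

adjust : ∀ {n} → Fin n → (ℕ → ℕ) → Fin n → ℕ → ℕ
adjust i f k = if does (i Fin.≟ k) then f else id

lookup-%= : ∀ {n} (c : Vec ℕ n) i f k → lookup (c [ i ]%= f) k ≡ adjust i f k (lookup c k)
lookup-%= c i f k with i Fin.≟ k
... | yes refl = Vecₚ.lookup∘updateAt i c
... | no  i≢k  = Vecₚ.lookup∘updateAt′ k i (i≢k ∘ sym) c

adjust-mono : ∀ {n} (i : Fin n) {f} k → (∀ {a b} → a ≤ b → f a ≤ f b) →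
              ∀ {a b} → a ≤ b → adjust i f k a ≤ adjust i f k b
adjust-mono i k f-mono with i Fin.≟ k
... | yes _ = f-mono
... | no  _ = id

vectorsUpTo : ∀ n → ℕ → List (Vec ℕ n)
vectorsUpTo zero    B = [] ∷ []
vectorsUpTo (suc n) B = cartesianProductWith _∷_ (upTo (suc B)) (vectorsUpTo n B)

∈-vectorsUpTo⁺ : ∀ {n B} (c : Vec ℕ n) → (∀ k → lookup c k ≤ B) → c ∈ vectorsUpTo n B
∈-vectorsUpTo⁺ []      _ = here refl
∈-vectorsUpTo⁺ (x ∷ c) c≤B =
  ∈-cartesianProductWith⁺ _∷_ (∈-upTo⁺ (s≤s (c≤B Fin.zero))) (∈-vectorsUpTo⁺ c (c≤B ∘ Fin.suc))

∈-vectorsUpTo⁻ : ∀ {n B} (c : Vec ℕ n) → c ∈ vectorsUpTo n B → ∀ k → lookup c k ≤ B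
∈-vectorsUpTo⁻ {suc n} {B} (x ∷ c) c∈ k
  with ∈-cartesianProductWith⁻ _∷_ (upTo (suc B)) (vectorsUpTo n B) c∈
... | x , c , x∈ , c∈′ , refl with k
...   | Fin.zero  = ≤-pred (∈-upTo⁻ x∈)
...   | Fin.suc k = ∈-vectorsUpTo⁻ c c∈′ k

bitVectors : ∀ n → List (Vec Bool n)
bitVectors zero    = [] ∷ []
bitVectors (suc n) = cartesianProductWith _∷_ (true ∷ false ∷ []) (bitVectors n)

∈-bitVectors : ∀ {n} (v : Vec Bool n) → v ∈ bitVectors n
∈-bitVectors []          = here refl
∈-bitVectors (b ∷ v)     = ∈-cartesianProductWith⁺ _∷_ {xs = true ∷ false ∷ []} (∈-bools b) (∈-bitVectors v)
  where
  ∈-bools : ∀ b → b ∈ true ∷ false ∷ []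
  ∈-bools true  = here refl
  ∈-bools false = there (here refl)

-- `leqS` and `_==S_` compare counters by helpers local to their definitions, which cannot be
-- named.  The helpers' equations are recovered by abstracting the compared vectors (hence the
-- record fields whose types mention their length) and letting Agda infer the helper from the use.
module Unfold {nA mA mB : ℕ} (initA : Fin nA) where

  private
    templates : ∀ nB → Fin nB → (Fin mA → Fin nA × Guard nA nB × Fin nA) →
                (Fin mB → Fin nB × Guard nA nB × Fin nB) → Templates
    templates nB initB transA transB = record
      { nA = nA ; nB = nB ; mA = mA ; mB = mB
      ; initA = initA ; initB = initB ; transA = transA ; transB = transB }

  mutual
    leqS-unfold : ∀ {nB initB transA transB} (let open Proc (templates nB initB transA transB))
                  q c q' d → leqS (q , c) (q' , d) ≡ (q == q') ∧ (c ≼ᵇ d)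
    leqS-unfold {zero} q [] q' [] = refl
    leqS-unfold {suc n} {initB} {transA} {transB} q (x ∷ xs) q' (y ∷ ys)
      with suc n | initB | transA | transB | x ∷ xs | y ∷ ys
    ... | nB | iB | tA | tB | c | d =
      cong (λ b → Proc._==_ (templates nB iB tA tB) q q' ∧ ((x ≤ᵇ y) ∧ b))
           (leqV-unfold iB tA tB q c q' d xs ys)

    leqV-unfold : ∀ {nB} (initB : Fin nB) (transA : Fin mA → Fin nA × Guard nA nB × Fin nA)
                  (transB : Fin mB → Fin nB × Guard nA nB × Fin nB)
                  (q : Fin nA) (c : Vec ℕ nB) (q' : Fin nA) (d : Vec ℕ nB) {k} (xs ys : Vec ℕ k) →
                  _ ≡ (xs ≼ᵇ ys)
    leqV-unfold iB tA tB q c q' d [] [] = refl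
    leqV-unfold iB tA tB q c q' d (x ∷ xs) (y ∷ ys) =
      cong ((x ≤ᵇ y) ∧_) (leqV-unfold iB tA tB q c q' d xs ys)

  mutual
    ==S-unfold : ∀ {nB initB transA transB} (let open Proc (templates nB initB transA transB))
                 q c q' d → ((q , c) ==S (q' , d)) ≡ (q == q') ∧ (c ≡ᵇ d)
    ==S-unfold {zero} q [] q' [] = refl
    ==S-unfold {suc n} {initB} {transA} {transB} q (x ∷ xs) q' (y ∷ ys)
      with suc n | initB | transA | transB | x ∷ xs | y ∷ ys
    ... | nB | iB | tA | tB | c | d =
      cong (λ b → Proc._==_ (templates nB iB tA tB) q q' ∧ (does (x ℕ.≟ y) ∧ b))
           (vecEq-unfold iB tA tB q c q' d xs ys)

    vecEq-unfold : ∀ {nB} (initB : Fin nB) (transA : Fin mA → Fin nA × Guard nA nB × Fin nA)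
                 (transB : Fin mB → Fin nB × Guard nA nB × Fin nB)
                 (q : Fin nA) (c : Vec ℕ nB) (q' : Fin nA) (d : Vec ℕ nB) {k} (xs ys : Vec ℕ k) →
                 _ ≡ (xs ≡ᵇ ys)
    vecEq-unfold iB tA tB q c q' d [] [] = refl
    vecEq-unfold iB tA tB q c q' d (x ∷ xs) (y ∷ ys) =
      cong (does (x ℕ.≟ y) ∧_) (vecEq-unfold iB tA tB q c q' d xs ys)

-- The counter system and the repair loop

module Repair (Tm : Templates) where
  open Templates Tm
  open Proc Tm

  _⊑_ : Rel State 0ℓ
  _⊑_ = _≡×≼_

  ==⇒≡ : ∀ {n} {i j : Fin n} → T (i == j) → i ≡ j
  ==⇒≡ {i = i} {j} = does⇒ (i Fin.≟ j)

  ≡⇒== : ∀ {n} {i j : Fin n} → i ≡ j → T (i == j)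
  ≡⇒== {i = i} {j} = ⇒does (i Fin.≟ j)

  leqS≡ : ∀ q c q' d → leqS (q , c) (q' , d) ≡ (q == q') ∧ (c ≼ᵇ d)
  leqS≡ = Unfold.leqS-unfold {mA = mA} {mB} initA {nB} {initB} {transA} {transB}

  ==S≡ : ∀ q c q' d → ((q , c) ==S (q' , d)) ≡ (q == q') ∧ (c ≡ᵇ d)
  ==S≡ = Unfold.==S-unfold {mA = mA} {mB} initA {nB} {initB} {transA} {transB}

  ≲⇒⊑ : ∀ s s' → s ≲ s' → s ⊑ s'
  ≲⇒⊑ (q , c) (q' , d) le with to (T-∧ {q == q'}) (subst T (leqS≡ q c q' d) le)
  ... | q≡q' , c≼d = ==⇒≡ q≡q' , ≼ᵇ⇒≼ {c = c} {d} c≼d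

  ⊑⇒≲ : ∀ s s' → s ⊑ s' → s ≲ s'
  ⊑⇒≲ (q , c) (q' , d) (q≡q' , c≼d) =
    subst T (sym (leqS≡ q c q' d)) (from T-∧ (≡⇒== q≡q' , ≼⇒≼ᵇ {c = c} {d} c≼d))

  ==S-refl : ∀ s → T (s ==S s)
  ==S-refl (q , c) = subst T (sym (==S≡ q c q c)) (from T-∧ (≡⇒== {i = q} refl , ≡ᵇ-refl c))

  ⊑-refl : ∀ s → s ⊑ s
  ⊑-refl _ = refl , λ k → ≤-refl

  ⊑-trans : ∀ s s' s'' → s ⊑ s' → s' ⊑ s'' → s ⊑ s''
  ⊑-trans _ _ _ (refl , c≼c') (refl , c'≼c'') = refl , λ k → ≤-trans (c≼c' k) (c'≼c'' k)

  ⊑-antisym : ∀ s s' → s ⊑ s' → s' ⊑ s → s ≡ s'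
  ⊑-antisym (q , c) (_ , d) (refl , c≼d) (_ , d≼c) = cong (q ,_) (≼-antisym {c = c} {d} c≼d d≼c)

  _⊑?_ : ∀ s s' → Dec (s ⊑ s')
  s ⊑? s' = map′ (≲⇒⊑ s s') (⊑⇒≲ s s') (T? (leqS s s'))

  _≟S_ : DecidableEquality State
  _≟S_ = ≡-dec Fin._≟_ (Vecₚ.≡-dec ℕ._≟_)

  srcA tgtA : Fin mA → Fin nA
  srcA t = proj₁ (transA t)
  tgtA t = proj₂ (proj₂ (transA t))

  srcB tgtB : Fin mB → Fin nB
  srcB t = proj₁ (transB t)
  tgtB t = proj₂ (proj₂ (transB t))

  guard : Trans → Guard nA nB
  guard (inj₁ t) = proj₁ (proj₂ (transA t))
  guard (inj₂ t) = proj₁ (proj₂ (transB t))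

  enabled : Trans → State → Bool
  enabled t@(inj₁ a) (q , c) = (q == srcA a) ∧ any (λ i → guard t (inj₂ i) ∧ (1 ≤ᵇ lookup c i)) (allFin nB)
  enabled t@(inj₂ b) (q , c) =
    (1 ≤ᵇ lookup c (srcB b))
    ∧ (guard t (inj₁ q)
       ∨ any (λ l → not (l == srcB b) ∧ guard t (inj₂ l) ∧ (1 ≤ᵇ lookup c l)) (allFin nB)
       ∨ (guard t (inj₂ (srcB b)) ∧ (2 ≤ᵇ lookup c (srcB b))))

  fire : Trans → State → State
  fire (inj₁ a) (q , c) = tgtA a , c
  fire (inj₂ b) (q , c) = q , (c [ srcB b ]%= pred) [ tgtB b ]%= suc

  post≡ : ∀ ρ s t → post ρ s t ≡ (if ρ t ∧ enabled t s then just (fire t s) else nothing)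
  post≡ ρ (q , c) (inj₁ a) with ρ (inj₁ a) | transA a
  ... | false | _ = refl
  ... | true  | _ = refl
  post≡ ρ (q , c) (inj₂ b) with ρ (inj₂ b) | transB b
  ... | false | _ = refl
  ... | true  | _ = refl

  post-just : ∀ ρ s t {u} → post ρ s t ≡ just u → T (ρ t) × T (enabled t s) × fire t s ≡ u
  post-just ρ s t eq with ρ t ∧ enabled t s in en | trans (sym (post≡ ρ s t)) eq
  ... | true | refl = Prod.map₂ (_, refl) (to T-∧ (subst T (sym en) _))

  post-enabled : ∀ ρ s t → T (ρ t) → T (enabled t s) → post ρ s t ≡ just (fire t s)
  post-enabled ρ s t ρt en rewrite post≡ ρ s t with ρ t ∧ enabled t s | from T-∧ (ρt , en)
  ... | true | _ = refl

  -- The guards compare counters only with 1 and 2, hence the second disjunct.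
  _≤₂_ : Vec ℕ nB → Vec ℕ nB → Set
  c ≤₂ d = ∀ k → lookup c k ≤ lookup d k ⊎ 2 ≤ lookup d k

  enabled-≤₂ : ∀ t {q c d} → c ≤₂ d → T (enabled t (q , c)) → T (enabled t (q , d))
  enabled-≤₂ t@(inj₁ a) c≤₂d =
    T-∧-map id (T-any-map (allFin nB) (λ {i} → T-∧-map {guard t _} id (≤ᵇ-mono₂ (c≤₂d i) (s≤s z≤n))))
  enabled-≤₂ t@(inj₂ b) c≤₂d =
    T-∧-map (≤ᵇ-mono₂ (c≤₂d (srcB b)) (s≤s z≤n))
      (T-∨-map {guard t _} id
        (T-∨-map (T-any-map (allFin nB) (λ {l} → T-∧-map {not (l == srcB b)} id
                                                     (T-∧-map {guard t _} id (≤ᵇ-mono₂ (c≤₂d l) (s≤s z≤n)))))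
                 (T-∧-map {guard t _} id (≤ᵇ-mono₂ (c≤₂d (srcB b)) ≤-refl))))

  effect : Trans → Fin nB → ℕ → ℕ
  effect (inj₁ a) k = id
  effect (inj₂ b) k = adjust (tgtB b) suc k ∘ adjust (srcB b) pred k

  lookup-fire : ∀ t q c k → lookup (proj₂ (fire t (q , c))) k ≡ effect t k (lookup c k)
  lookup-fire (inj₁ a) q c k = refl
  lookup-fire (inj₂ b) q c k =
    trans (lookup-%= (c [ srcB b ]%= pred) (tgtB b) suc k)
          (cong (adjust (tgtB b) suc k) (lookup-%= c (srcB b) pred k))

  effect-mono : ∀ t k {a b} → a ≤ b → effect t k a ≤ effect t k b
  effect-mono (inj₁ a) k = id
  effect-mono (inj₂ b) k = adjust-mono (tgtB b) k s≤s ∘ adjust-mono (srcB b) k pred-mono-≤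

  ≤1+effect : ∀ t k a → a ≤ suc (effect t k a)
  ≤1+effect (inj₁ _) k a = n≤1+n a
  ≤1+effect (inj₂ b) k a = ≤-trans (decrease-by-one a) (s≤s (no-decrease _))
    where
    decrease-by-one : ∀ a → a ≤ suc (adjust (srcB b) pred k a)
    decrease-by-one a with srcB b Fin.≟ k | a
    ... | yes _ | zero  = z≤n
    ... | yes _ | suc a = ≤-refl
    ... | no  _ | a     = n≤1+n a
    no-decrease : ∀ a → a ≤ adjust (tgtB b) suc k a
    no-decrease a with tgtB b Fin.≟ k
    ... | yes _ = n≤1+n a
    ... | no  _ = ≤-refl

  fire-target : ∀ t q c d → proj₁ (fire t (q , c)) ≡ proj₁ (fire t (q , d))
  fire-target (inj₁ _) q c d = refl
  fire-target (inj₂ _) q c d = refl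

  fire-mono : ∀ t q {c d} → c ≼ d → fire t (q , c) ⊑ fire t (q , d)
  fire-mono t q {c} {d} c≼d = fire-target t q c d , λ k →
    subst₂ _≤_ (sym (lookup-fire t q c k)) (sym (lookup-fire t q d k)) (effect-mono t k (c≼d k))

  post-mono : ∀ ρ s s' t {u} → s ⊑ s' → post ρ s t ≡ just u → ∃ λ u' → post ρ s' t ≡ just u' × u ⊑ u'
  post-mono ρ (q , c) (_ , d) t (refl , c≼d) fires with post-just ρ (q , c) t fires
  ... | ρt , en , refl =
    fire t (q , d) , post-enabled ρ (q , d) t ρt (enabled-≤₂ t (inj₁ ∘ c≼d) en) , fire-mono t q c≼d

  ∈-allTrans : ∀ t → t ∈ allTrans
  ∈-allTrans (inj₁ a) = ∈-++⁺ˡ (∈-map⁺ inj₁ (∈-allFin a))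
  ∈-allTrans (inj₂ b) = ∈-++⁺ʳ (map inj₁ (allFin mA)) (∈-map⁺ inj₂ (∈-allFin b))

  inUp⇒ : ∀ E s → T (inUp E s) → ∃ λ e → e ∈ E × e ⊑ s
  inUp⇒ E s up with find (any⁻ _ E up)
  ... | e , e∈E , e≲s = e , e∈E , ≲⇒⊑ e s e≲s

  ⇒inUp : ∀ E {e} s → e ∈ E → e ⊑ s → T (inUp E s)
  ⇒inUp E {e} s e∈E e⊑s = any⁺ _ (lose e∈E (⊑⇒≲ e s e⊑s))

  inUp-mono : ∀ E s s' → T (inUp E s) → s ⊑ s' → T (inUp E s')
  inUp-mono E s s' up s⊑s' with inUp⇒ E s up
  ... | e , e∈E , e⊑s = ⇒inUp E s' e∈E (⊑-trans e s s' e⊑s s⊑s')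

  inPredUp⇒ : ∀ ρ E s → T (inPredUp ρ E s) → ∃ λ t → ∃ λ u → post ρ s t ≡ just u × T (inUp E u)
  inPredUp⇒ ρ E s pre with find (any⁻ _ allTrans pre)
  ... | t , _ , up with post ρ s t in fires
  ...   | just u = t , u , fires , up

  ⇒inPredUp : ∀ ρ E s t {u} → post ρ s t ≡ just u → T (inUp E u) → T (inPredUp ρ E s)
  ⇒inPredUp ρ E s t fires up = any⁺ _ (lose (∈-allTrans t) (subst (T ∘ maybeIn (inUp E)) (sym fires) up))

  inPredUp-mono : ∀ ρ E s s' → T (inPredUp ρ E s) → s ⊑ s' → T (inPredUp ρ E s')
  inPredUp-mono ρ E s s' pre s⊑s' with inPredUp⇒ ρ E s pre
  ... | t , u , fires , up with post-mono ρ s s' t s⊑s' fires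
  ...   | u' , fires' , u⊑u' = ⇒inPredUp ρ E s' t fires' (inUp-mono E u u' up u⊑u')

  mutual
    ∈-Succ : ∀ ρ X s t {u} → s ∈ X → post ρ s t ≡ just u → u ∈ Succ ρ X
    ∈-Succ ρ X s t s∈X fires =
      ∈-concatMap⁺ _ (lose s∈X (∈-concatMap⁺ _ (lose (∈-allTrans t) (∈-successors ρ X s t fires))))

    -- `Succ` lists the successors by a local helper; its type here is inferred from the use above
    ∈-successors : ∀ ρ X s t {u} → post ρ s t ≡ just u → u ∈ _
    ∈-successors ρ X s t fires with post ρ s t | fires
    ... | just _ | refl = here refl

  ⇒elem : ∀ {s X} → s ∈ X → T (elem s X)
  ⇒elem {s} s∈X = any⁺ _ (lose s∈X (==S-refl s))

  MinimalIn : List State → State → Set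
  MinimalIn L s = All (λ s' → s' ⊑ s → s' ≡ s) L

  minimal? : ∀ L s → Dec (MinimalIn L s)
  minimal? L s = All.all? (λ s' → (s' ⊑? s) →-dec (s' ≟S s)) L

  minimals : List State → List State
  minimals L = filter (minimal? L) L

  minimals-isMinBasis : ∀ L → IsMinBasis (_∈ L) (minimals L)
  minimals-isMinBasis L s = to-min , from-min
    where
    to-min : s ∈ minimals L → s ∈ L × (∀ s' → s' ∈ L → s' ≲ s → s' ≡ s)
    to-min s∈min with ∈-filter⁻ (minimal? L) s∈min
    ... | s∈L , min = s∈L , λ s' s'∈L s'≲s → All.lookup min s'∈L (≲⇒⊑ s' s s'≲s)
    from-min : s ∈ L × (∀ s' → s' ∈ L → s' ≲ s → s' ≡ s) → s ∈ minimals L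
    from-min (s∈L , min) =
      ∈-filter⁺ (minimal? L) s∈L (All.tabulate λ {s'} s'∈L s'⊑s → min s' s'∈L (⊑⇒≲ s' s s'⊑s))

  size : State → ℕ
  size (_ , c) = sum c

  size-< : ∀ s s' → s ⊑ s' → s ≢ s' → size s < size s'
  size-< (q , c) (_ , d) (refl , c≼d) s≢s' = sum-< {c = c} {d} c≼d (s≢s' ∘ cong (q ,_))

  above-minimal : ∀ {L M} → IsMinBasis (_∈ L) M → ∀ {s} → s ∈ L → ∃ λ m → m ∈ M × m ⊑ s
  above-minimal {L} {M} basis {s} = go s (<-wellFounded (size s))
    where
    go : ∀ s → Acc _<_ (size s) → s ∈ L → ∃ λ m → m ∈ M × m ⊑ s
    go s (acc smaller) s∈L with minimal? L s
    ... | yes min =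
      s , proj₂ (basis s) (s∈L , λ s' s'∈L s'≲s → All.lookup min s'∈L (≲⇒⊑ s' s s'≲s)) , ⊑-refl s
    ... | no ¬min with find (¬All⇒Any¬ (λ s' → (s' ⊑? s) →-dec (s' ≟S s)) L ¬min)
    ...   | s' , s'∈L , not-below with s' ⊑? s | s' ≟S s
    ...     | no s'⋢s  | _        = contradiction (λ s'⊑s → contradiction s'⊑s s'⋢s) not-below
    ...     | yes _    | yes s'≡s = contradiction (λ _ → s'≡s) not-below
    ...     | yes s'⊑s | no s'≢s with go s' (smaller (size-< s' s s'⊑s s'≢s)) s'∈L
    ...       | m , m∈M , m⊑s' = m , m∈M , ⊑-trans m s' s m⊑s' s'⊑s

  decrement-≤₂ : ∀ c j → 3 ≤ lookup c j → c ≤₂ (c [ j ]%= pred)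
  decrement-≤₂ c j 3≤cj k with j Fin.≟ k
  ... | yes refl = inj₂ (subst (2 ≤_) (sym (Vecₚ.lookup∘updateAt j c)) (suc[m]≤n⇒m≤pred[n] 3≤cj))
  ... | no  j≢k  = inj₁ (≤-reflexive (sym (Vecₚ.lookup∘updateAt′ k j (j≢k ∘ sym) c)))

  fire-decrement : ∀ t q {c d B} j → d ≼ proj₂ (fire t (q , c)) → (∀ k → lookup d k ≤ B) →
                   3 + B ≤ lookup c j →
                   d ≼ proj₂ (fire t (q , c [ j ]%= pred))
  fire-decrement t q {c} {d} {B} j d≼ d≤B 3+B≤cj k with j Fin.≟ k
  ... | yes refl = begin
    lookup d j                                     ≤⟨ d≤B j ⟩
    B                                              <⟨ B<effect ⟩
    effect t j (pred (lookup c j))                 ≡⟨ cong (effect t j) (Vecₚ.lookup∘updateAt j c) ⟨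
    effect t j (lookup (c [ j ]%= pred) j)         ≡⟨ lookup-fire t q (c [ j ]%= pred) j ⟨
    lookup (proj₂ (fire t (q , c [ j ]%= pred))) j ∎
    where
    open ≤-Reasoning
    B<effect : B < effect t j (pred (lookup c j))
    B<effect = ≤-pred (≤-trans (suc[m]≤n⇒m≤pred[n] 3+B≤cj) (≤1+effect t j _))
  ... | no  j≢k  = begin
    lookup d k                                     ≤⟨ d≼ k ⟩
    lookup (proj₂ (fire t (q , c))) k              ≡⟨ lookup-fire t q c k ⟩
    effect t k (lookup c k)                        ≡⟨ cong (effect t k) (Vecₚ.lookup∘updateAt′ k j j≢k′ c) ⟨
    effect t k (lookup (c [ j ]%= pred) k)         ≡⟨ lookup-fire t q (c [ j ]%= pred) k ⟨
    lookup (proj₂ (fire t (q , c [ j ]%= pred))) k ∎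
    where
    open ≤-Reasoning
    j≢k′ : k ≢ j
    j≢k′ = j≢k ∘ sym

  counterBound : List State → ℕ
  counterBound []            = 0
  counterBound ((_ , c) ∷ E) = sum c + counterBound E

  counterBound-≥ : ∀ {E e} → e ∈ E → ∀ k → lookup (proj₂ e) k ≤ counterBound E
  counterBound-≥ {(_ , c) ∷ E} (here refl) k = ≤-trans (lookup≤sum c k) (m≤m+n (sum c) _)
  counterBound-≥ {(_ , c) ∷ E} (there e∈E) k = ≤-trans (counterBound-≥ e∈E k) (m≤n+m _ (sum c))

  box : ℕ → List State
  box B = cartesianProduct (allFin nA) (vectorsUpTo nB B)

  ∈-box⁺ : ∀ {B} q c → (∀ k → lookup c k ≤ B) → (q , c) ∈ box B
  ∈-box⁺ q c c≤B = ∈-cartesianProduct⁺ (∈-allFin q) (∈-vectorsUpTo⁺ c c≤B)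

  ∈-box⁻ : ∀ {B} q c → (q , c) ∈ box B → ∀ k → lookup c k ≤ B
  ∈-box⁻ {B} q c s∈ with ∈-cartesianProduct⁻ (allFin nA) (vectorsUpTo nB B) s∈
  ... | _ , c∈ = ∈-vectorsUpTo⁻ c c∈

  inBox? : ∀ B c → (∀ k → lookup c k ≤ B) ⊎ ∃ λ k → B < lookup c k
  inBox? B c with Finₚ.all? (λ k → lookup c k ℕ.≤? B)
  ... | yes c≤B = inj₁ c≤B
  ... | no  c≰B = inj₂ (Prod.map₂ ≰⇒> (Finₚ.¬∀⟶∃¬ nB _ (λ k → lookup c k ℕ.≤? B) c≰B))

  -- The guards cannot see a decrement of a counter that stays ≥ 2, and the successor still lies above E.
  inPredUp-decrement : ∀ ρ E q c j → T (inPredUp ρ E (q , c)) → 3 + counterBound E ≤ lookup c j →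
                       T (inPredUp ρ E (q , c [ j ]%= pred))
  inPredUp-decrement ρ E q c j pre big with inPredUp⇒ ρ E (q , c) pre
  ... | t , u , fires , up with post-just ρ (q , c) t fires | inUp⇒ E u up
  ...   | ρt , en , refl | e , e∈E , (e≡ , e≼) =
    ⇒inPredUp ρ E (q , c') t fires' (⇒inUp E (fire t (q , c')) e∈E e⊑)
    where
    c' : Vec ℕ nB
    c' = c [ j ]%= pred
    fires' : post ρ (q , c') t ≡ just (fire t (q , c'))
    fires' = post-enabled ρ (q , c') t ρt (enabled-≤₂ t (decrement-≤₂ c j (≤-trans (m≤m+n 3 _) big)) en)
    e⊑ : e ⊑ fire t (q , c')
    e⊑ = trans e≡ (fire-target t q c c') , fire-decrement t q {d = proj₂ e} j e≼ (counterBound-≥ e∈E) big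

  decrement-⊑ : ∀ (q : Fin nA) c j → (q , c [ j ]%= pred) ⊑ (q , c)
  decrement-⊑ q c j = refl , λ k → subst (_≤ lookup c k) (sym (lookup-%= c j pred k)) (adjust-≤ k)
    where
    adjust-≤ : ∀ k → adjust j pred k (lookup c k) ≤ lookup c k
    adjust-≤ k with j Fin.≟ k
    ... | yes _ = pred[n]≤n
    ... | no  _ = ≤-refl

  decrement-≢ : ∀ (q : Fin nA) (c : Vec ℕ nB) j → 0 < lookup c j → (q , c [ j ]%= pred) ≢ (q , c)
  decrement-≢ q c j 0<cj eq =
    pred≢ 0<cj (trans (sym (Vecₚ.lookup∘updateAt j c)) (cong (λ s → lookup (proj₂ s) j) eq))
    where
    pred≢ : ∀ {n} → 0 < n → pred n ≢ n
    pred≢ (s≤s _) = 1+n≢n ∘ sym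

  -- By inPredUp-decrement every minimal predecessor lies in the box bounded by 2 + counterBound E.
  predecessorBasis : ∀ ρ E → ∃ λ Ei → IsMinBasis (λ s → T (inPredUp ρ E s)) Ei
  predecessorBasis ρ E = minimals candidates , basis
    where
    B : ℕ
    B = 2 + counterBound E

    candidates : List State
    candidates = filterᵇ (inPredUp ρ E) (box B)

    ∈-candidates⁺ : ∀ {s} → s ∈ box B → T (inPredUp ρ E s) → s ∈ candidates
    ∈-candidates⁺ = ∈-filter⁺ (T? ∘ inPredUp ρ E)

    ∈-candidates⁻ : ∀ {s} → s ∈ candidates → s ∈ box B × T (inPredUp ρ E s)
    ∈-candidates⁻ = ∈-filter⁻ (T? ∘ inPredUp ρ E) {xs = box B}

    basis : IsMinBasis (λ s → T (inPredUp ρ E s)) (minimals candidates)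
    basis s@(q , c) = to-min , from-min
      where
      to-min : s ∈ minimals candidates → T (inPredUp ρ E s) × (∀ s' → T (inPredUp ρ E s') → s' ≲ s → s' ≡ s)
      to-min s∈min with proj₁ (minimals-isMinBasis candidates s) s∈min
      ... | s∈cand , min with ∈-candidates⁻ s∈cand
      ...   | s∈box , pre = pre , λ { s'@(q' , c') pre' s'≲s →
        min s' (∈-candidates⁺ (∈-box⁺ q' c' λ k → ≤-trans (proj₂ (≲⇒⊑ s' s s'≲s) k) (∈-box⁻ q c s∈box k)) pre')
          s'≲s }

      from-min : T (inPredUp ρ E s) × (∀ s' → T (inPredUp ρ E s') → s' ≲ s → s' ≡ s) →
                 s ∈ minimals candidates
      from-min (pre , min) with inBox? B c
      ... | inj₁ c≤B = proj₂ (minimals-isMinBasis candidates s)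
            (∈-candidates⁺ (∈-box⁺ q c c≤B) pre , λ s' s'∈cand → min s' (proj₂ (∈-candidates⁻ s'∈cand)))
      ... | inj₂ (j , B<cj) =
        contradiction (min s↓ (inPredUp-decrement ρ E q c j pre B<cj) (⊑⇒≲ s↓ s (decrement-⊑ q c j)))
                      (decrement-≢ q c j (≤-trans (s≤s z≤n) B<cj))
        where
        s↓ : State
        s↓ = q , c [ j ]%= pred

  fromBits : Vec Bool mA × Vec Bool mB → Assignment
  fromBits (u , v) = [ lookup u , lookup v ]

  toBits : Assignment → Vec Bool mA × Vec Bool mB
  toBits ρ = tabulate (ρ ∘ inj₁) , tabulate (ρ ∘ inj₂)

  assignments : List Assignment
  assignments = map fromBits (cartesianProduct (bitVectors mA) (bitVectors mB))

  fromBits∘toBits : ∀ ρ t → fromBits (toBits ρ) t ≡ ρ t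
  fromBits∘toBits ρ (inj₁ a) = Vecₚ.lookup∘tabulate (ρ ∘ inj₁) a
  fromBits∘toBits ρ (inj₂ b) = Vecₚ.lookup∘tabulate (ρ ∘ inj₂) b

  toBits∈assignments : ∀ ρ → fromBits (toBits ρ) ∈ assignments
  toBits∈assignments ρ =
    ∈-map⁺ fromBits (∈-cartesianProduct⁺ (∈-bitVectors (proj₁ (toBits ρ))) (∈-bitVectors (proj₂ (toBits ρ))))

  eval-cong : ∀ {ρ ρ'} → (∀ t → ρ t ≡ ρ' t) → ∀ f → eval ρ f ≡ eval ρ' f
  eval-cong ρ≗ρ' (var t)  = ρ≗ρ' t
  eval-cong ρ≗ρ' tt       = refl
  eval-cong ρ≗ρ' ff       = refl
  eval-cong ρ≗ρ' (¬' f)   = cong not (eval-cong ρ≗ρ' f)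
  eval-cong ρ≗ρ' (f ∧' g) = cong₂ _∧_ (eval-cong ρ≗ρ' f) (eval-cong ρ≗ρ' g)
  eval-cong ρ≗ρ' (f ∨' g) = cong₂ _∨_ (eval-cong ρ≗ρ' f) (eval-cong ρ≗ρ' g)

  eval-toBits : ∀ ρ f → eval (fromBits (toBits ρ)) f ≡ eval ρ f
  eval-toBits ρ = eval-cong (fromBits∘toBits ρ)

  satisfiable? : ∀ f → Satisfiable f ⊎ (∀ ρ → eval ρ f ≡ false)
  satisfiable? f with any? (λ ρ → T? (eval ρ f)) assignments
  ... | yes sat  = inj₁ (Prod.map₂ (to T-≡ ∘ proj₂) (find sat))
  ... | no unsat = inj₂ λ ρ → ¬T⇒≡false λ ρ⊨f →
    unsat (lose (toBits∈assignments ρ) (subst T (sym (eval-toBits ρ f)) ρ⊨f))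
    where
    ¬T⇒≡false : ∀ {b} → ¬ T b → b ≡ false
    ¬T⇒≡false {false} _ = refl
    ¬T⇒≡false {true}  ¬t = contradiction _ ¬t

  models : Formula → ℕ
  models f = length (filterᵇ (λ ρ → eval ρ f) assignments)

  models-∧-< : ∀ ρ φ ψ → eval ρ ψ ≡ true → eval ρ φ ≡ false → models (φ ∧' ψ) < models ψ
  models-∧-< ρ φ ψ ρ⊨ψ ρ⊭φ =
    length-filterᵇ-< assignments (λ {ρ'} → proj₂ ∘ to (T-∧ {eval ρ' φ})) (toBits∈assignments ρ)
      (from T-≡ (trans (eval-toBits ρ ψ) ρ⊨ψ))
      (subst T (trans (eval-toBits ρ (φ ∧' ψ)) (cong (_∧ eval ρ ψ) ρ⊭φ)))

  ⋀-false : ∀ ρ {A : Set} {h : A → Formula} {xs x f} → x ∈ xs → h x ≡ f → eval ρ f ≡ false →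
            eval ρ (⋀ (map h xs)) ≡ false
  ⋀-false ρ (here refl) refl ρ⊭f rewrite ρ⊭f = refl
  ⋀-false ρ {h = h} {y ∷ _} (there x∈xs) hx≡f ρ⊭f =
    trans (cong (eval ρ (h y) ∧_) (⋀-false ρ x∈xs hx≡f ρ⊭f)) (∧-zeroʳ (eval ρ (h y)))

  ¬var-false : ∀ ρ t → T (ρ t) → eval ρ (¬' var t) ≡ false
  ¬var-false ρ t ρt = cong not (to T-≡ ρt)

  -- `BC` inspects `post ρ s t` in a local helper, the inferred left-hand side of the `…-branch`
  -- lemmas; their uses pass `u` explicitly, as otherwise that inference is postponed and fails.
  mutual
    BC-last-false : ∀ ρ s X t {u} → post ρ s t ≡ just u → T (elem u X) → eval ρ (BC ρ s (X ∷ [])) ≡ false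
    BC-last-false ρ s X t {u} fires u∈X =
      ⋀-false ρ (∈-allTrans t) (BC-last-branch ρ s X t {u} fires u∈X)
        (¬var-false ρ t (proj₁ (post-just ρ s t fires)))

    BC-last-branch : ∀ ρ s X t {u} → post ρ s t ≡ just u → T (elem u X) → _ ≡ ¬' var t
    BC-last-branch ρ s X t fires u∈X with post ρ s t | fires
    ... | just u | refl with elem u X | u∈X
    ...   | true | _ = refl

  mutual
    BC-step-false : ∀ ρ s X Y Xs t {u} → post ρ s t ≡ just u → T (elem u X) →
                    eval ρ (BC ρ u (Y ∷ Xs)) ≡ false →
                    eval ρ (BC ρ s (X ∷ Y ∷ Xs)) ≡ false
    BC-step-false ρ s X Y Xs t {u} fires u∈X rest =
      ⋀-false ρ (∈-allTrans t) (BC-step-branch ρ s X Y Xs t {u} fires u∈X)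
        (cong₂ _∨_ (¬var-false ρ t (proj₁ (post-just ρ s t fires))) rest)

    BC-step-branch : ∀ ρ s X Y Xs t {u} → post ρ s t ≡ just u → T (elem u X) →
                     _ ≡ (¬' var t) ∨' BC ρ u (Y ∷ Xs)
    BC-step-branch ρ s X Y Xs t fires u∈X with post ρ s t | fires
    ... | just u | refl with elem u X | u∈X
    ...   | true | _ = refl

  backward : Assignment → List (List State) → List State → List (List State)
  backward ρ []       RE = []
  backward ρ (F ∷ Fs) RE = let RE' = filterᵇ (inUp F) (Succ ρ RE) in RE' ∷ backward ρ Fs RE'

  -- `REs` iterates a local helper; `backward-unfold` gives its equations, with the helper inferred.
  mutual
    REs≡backward : ∀ ρ Es R → REs ρ Es R ≡ backward ρ (reverse Es) R
    REs≡backward ρ Es R with reverse Es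
    ... | []     = refl
    ... | F ∷ Fs with filterᵇ (inUp F) (Succ ρ R)
    ...   | RE = cong (RE ∷_) (backward-unfold ρ Es R Fs RE)

    backward-unfold : ∀ ρ Es R Fs RE → _ ≡ backward ρ Fs RE
    backward-unfold ρ Es R []       RE = refl
    backward-unfold ρ Es R (F ∷ Fs) RE =
      cong (_ ∷_) (backward-unfold ρ Es R Fs (filterᵇ (inUp F) (Succ ρ RE)))

  PredChain : Assignment → List (List State) → Set
  PredChain ρ (F ∷ F' ∷ Fs) = (∀ {x} → x ∈ F → T (inPredUp ρ F' x)) × PredChain ρ (F' ∷ Fs)
  PredChain ρ _             = ⊤

  BC-backward-false : ∀ ρ F Fs R {s} → PredChain ρ (F ∷ Fs) → s ∈ R → T (inPredUp ρ F s) →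
                      eval ρ (BC ρ s (backward ρ (F ∷ Fs) R)) ≡ false
  BC-backward-false ρ F Fs R {s} chain s∈R pre with inPredUp⇒ ρ F s pre
  ... | t , u , fires , up = along Fs chain
    where
    RE : List State
    RE = filterᵇ (inUp F) (Succ ρ R)

    u∈RE : u ∈ RE
    u∈RE = ∈-filter⁺ (T? ∘ inUp F) (∈-Succ ρ R s t s∈R fires) up

    along : ∀ Fs → PredChain ρ (F ∷ Fs) → eval ρ (BC ρ s (backward ρ (F ∷ Fs) R)) ≡ false
    along []         _                 = BC-last-false ρ s RE t fires (⇒elem u∈RE)
    along (F' ∷ Fs') (F⊆pred , chain') =
      BC-step-false ρ s RE RE' (backward ρ Fs' RE') t fires (⇒elem u∈RE)
        (BC-backward-false ρ F' Fs' RE chain' u∈RE u-pre)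
      where
      RE' : List State
      RE' = filterᵇ (inUp F') (Succ ρ RE)
      u-pre : T (inPredUp ρ F' u)
      u-pre with inUp⇒ F u up
      ... | e , e∈F , e⊑u = inPredUp-mono ρ F' e u (F⊆pred e∈F) e⊑u

  Backchained : Assignment → List (List State) → Set
  Backchained ρ Es = ∃ λ Fs → reverse Es ≡ lastE Es ∷ Fs × PredChain ρ (lastE Es ∷ Fs)

  newConstraint-false : ∀ ρ Es Ek {s} → Backchained ρ Es → s ∈ Ek →
                        (∀ {x} → x ∈ Ek → T (inPredUp ρ (lastE Es) x)) →
                        eval ρ (⋀ (map (λ s → BC ρ s (REs ρ Es Ek)) Ek)) ≡ false
  newConstraint-false ρ Es Ek {s} (Fs , rev≡ , chain) s∈Ek Ek⊆pred =
    ⋀-false ρ s∈Ek (cong (BC ρ s) (trans (REs≡backward ρ Es Ek) (cong (λ Fs → backward ρ Fs Ek) rev≡)))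
      (BC-backward-false ρ (lastE Es) Fs Ek chain s∈Ek (Ek⊆pred s∈Ek))

  lastE-∷ʳ : ∀ Es (E : List State) → lastE (Es ∷ʳ E) ≡ E
  lastE-∷ʳ []           E = refl
  lastE-∷ʳ (_ ∷ [])     E = refl
  lastE-∷ʳ (_ ∷ E' ∷ Es) E = lastE-∷ʳ (E' ∷ Es) E

  backchained-∷ʳ : ∀ ρ Es Ei → Backchained ρ Es → (∀ {x} → x ∈ Ei → T (inPredUp ρ (lastE Es) x)) →
                   Backchained ρ (Es ∷ʳ Ei)
  backchained-∷ʳ ρ Es Ei (Fs , rev≡ , chain) Ei⊆pred rewrite lastE-∷ʳ Es Ei =
    lastE Es ∷ Fs , trans (reverse-++ Es (Ei ∷ [])) (cong (Ei ∷_) rev≡) , Ei⊆pred , chain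

  Antichain : List State → Set
  Antichain L = ∀ {a b} → a ∈ L → b ∈ L → a ⊑ b → a ≡ b

  _⋐_ : List State → List State → Set
  V ⋐ T = ∀ {s} → s ∈ V → Any (_⊑ s) T

  above-⋐ : ∀ {V T} s → Any (_⊑ s) V → V ⋐ T → Any (_⊑ s) T
  above-⋐ s v⊑s V⋐T with find v⊑s
  ... | v , v∈V , v⊑s′ = Any.map (λ {t} t⊑v → ⊑-trans t v s t⊑v v⊑s′) (V⋐T v∈V)

  isMinBasis-⊆ : ∀ {P L} → IsMinBasis P L → ∀ {x} → x ∈ L → P x
  isMinBasis-⊆ basis {x} x∈L = proj₁ (proj₁ (basis x) x∈L)

  isMinBasis⇒antichain : ∀ {P L} → IsMinBasis P L → Antichain L
  isMinBasis⇒antichain basis {a} {b} a∈L b∈L a⊑b =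
    proj₂ (proj₁ (basis b) b∈L) a (isMinBasis-⊆ basis a∈L) (⊑⇒≲ a b a⊑b)

  isMinBasis-∈⇒⋐ : ∀ {L M} → IsMinBasis (_∈ L) M → L ⋐ M
  isMinBasis-∈⇒⋐ basis s∈L with above-minimal basis s∈L
  ... | m , m∈M , m⊑s = lose m∈M m⊑s

  -- Two antichains covering each other are equal as sets, so otherwise T has an element outside ↑V.
  new-element : ∀ {V T} → Antichain V → Antichain T → V ⋐ T → ¬ SetEq T V → ∃ λ g → g ∈ T × ¬ Any (_⊑ g) V
  new-element {V} {T} V-anti T-anti V⋐T T≉V with All.all? (λ g → Any.any? (_⊑? g) V) T
  ... | no  ¬covered = Prod.map₂ (Prod.map₂ id) (find (¬All⇒Any¬ (λ g → Any.any? (_⊑? g) V) T ¬covered))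
  ... | yes covered  = contradiction (λ s → T⊆V , V⊆T) T≉V
    where
    T⊆V : ∀ {s} → s ∈ T → s ∈ V
    T⊆V {s} s∈T with find (All.lookup covered s∈T)
    ... | v , v∈V , v⊑s with find (V⋐T v∈V)
    ...   | t , t∈T , t⊑v with T-anti t∈T s∈T (⊑-trans t v s t⊑v v⊑s)
    ...     | refl = subst (_∈ V) (⊑-antisym v s v⊑s t⊑v) v∈V
    V⊆T : ∀ {s} → s ∈ V → s ∈ T
    V⊆T {s} s∈V with find (V⋐T s∈V)
    ... | t , t∈T , t⊑s with find (All.lookup covered t∈T)
    ...   | v , v∈V , v⊑t with V-anti v∈V s∈V (⊑-trans v t s v⊑t t⊑s)
    ...     | refl = subst (_∈ T) (⊑-antisym t s t⊑s v⊑t) t∈T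

  open import Data.List.Relation.Binary.Subset.DecPropositional _≟S_ using (_⊆?_)

  setEq? : ∀ X Y → Dec (SetEq X Y)
  setEq? X Y with X ⊆? Y | Y ⊆? X
  ... | yes X⊆Y | yes Y⊆X = yes λ _ → X⊆Y , Y⊆X
  ... | no  X⊈Y | _       = no λ X≈Y → X⊈Y (proj₁ (X≈Y _))
  ... | _       | no  Y⊈X = no λ X≈Y → Y⊈X (proj₂ (X≈Y _))

  ∧'-true₁ : ∀ ρ f g → eval ρ (f ∧' g) ≡ true → eval ρ f ≡ true
  ∧'-true₁ ρ f g = to T-≡ ∘ proj₁ ∘ to (T-∧ {eval ρ f}) ∘ from T-≡

  module Termination (ERR : List State) (initConstr : Formula) where
    open Run ERR initConstr

    Restarts : Formula → Set
    Restarts ψ = ∀ ρ' ψ' → eval ρ' ψ' ≡ true → models ψ' < models ψ → Terminates (start ρ' ψ')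

    Continues : Assignment → Formula → List (List State) → List State → List State → Set
    Continues ρ ψ Es visited temp = ∀ {Ei temp'} → ¬ SetEq temp visited →
      IsMinBasis (λ s → T (inPredUp ρ (lastE Es) s)) Ei → filterᵇ isInit Ei ≡ [] →
      IsMinBasis (_∈ temp ++ Ei) temp' → Terminates (mcLoop ρ ψ (Es ∷ʳ Ei) temp temp')

    iteration-terminates : ∀ {ρ ψ Es visited temp} → eval ρ ψ ≡ true → Restarts ψ → Backchained ρ Es →
                           Continues ρ ψ Es visited temp → Terminates (mcLoop ρ ψ Es visited temp)
    iteration-terminates {ρ} {ψ} {Es} {visited} {temp} ρ⊨ψ restarts chained continue =
      term-step some-step every-step
      where
      some-step : ∃ λ c → mcLoop ρ ψ Es visited temp ⟶ c
      some-step with setEq? temp visited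
      ... | yes temp≈visited = _ , mc-true temp≈visited
      ... | no  temp≉visited with predecessorBasis ρ (lastE Es)
      ...   | Ei , basis with filterᵇ isInit Ei in init≡
      ...     | []    = _ , mc-iter temp≉visited basis init≡ (minimals-isMinBasis (temp ++ Ei))
      ...     | _ ∷ _ with satisfiable? (newAcc ρ ψ Es (filterᵇ isInit Ei) ∧' initConstr)
      ...       | inj₁ (ρ' , sat) = _ , mc-false-repair ρ' temp≉visited basis (∷≢[] init≡) sat
      ...       | inj₂ unsat      = _ , mc-false-unreal temp≉visited basis (∷≢[] init≡) unsat

      every-step : ∀ c → mcLoop ρ ψ Es visited temp ⟶ c → Terminates c
      every-step _ (mc-true _)                                = term-returned ρ
      every-step _ (mc-iter temp≉visited basis noInit basis') = continue temp≉visited basis noInit basis'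
      every-step _ (mc-false-unreal _ _ _ _)                  = term-unreal
      every-step _ (mc-false-repair {Ei = Ei} ρ' _ basis hasInit sat) =
        restarts ρ' (conflict ∧' ψ) (∧'-true₁ ρ' (conflict ∧' ψ) initConstr sat)
          (models-∧-< ρ conflict ψ ρ⊨ψ ρ⊭conflict)
        where
        Ek : List State
        Ek = filterᵇ isInit Ei
        conflict : Formula
        conflict = ⋀ (map (λ s → BC ρ s (REs ρ Es Ek)) Ek)
        ρ⊭conflict : eval ρ conflict ≡ false
        ρ⊭conflict = newConstraint-false ρ Es Ek chained (proj₂ (nonempty hasInit))
                       (isMinBasis-⊆ basis ∘ proj₁ ∘ ∈-filter⁻ (T? ∘ isInit) {xs = Ei})

    -- Each iteration adds to the history W an element of temp outside ↑visited; such histories are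
    -- bad sequences for ⊑, so the loop stops by Dickson's lemma.
    loop-terminates : ∀ {W} → Acc (BadExtension {_⊴_ = _⊑_}) W →
                      ∀ {ρ ψ Es visited temp} → eval ρ ψ ≡ true → Restarts ψ → Backchained ρ Es →
                      Antichain visited → Antichain temp → visited ⋐ temp → W ⋐ visited →
                      Terminates (mcLoop ρ ψ Es visited temp)
    loop-terminates {W} (acc shorter) {ρ} {ψ} {Es} {visited} {temp} ρ⊨ψ restarts chained
                    visited-anti temp-anti visited⋐temp W⋐visited =
      iteration-terminates ρ⊨ψ restarts chained continue
      where
      continue : Continues ρ ψ Es visited temp
      continue {Ei} temp≉visited basis _ basis'
        with g , g∈temp , g-new ← new-element visited-anti temp-anti visited⋐temp temp≉visited =
        loop-terminates (shorter (g , refl , λ w⊑g → g-new (above-⋐ g w⊑g W⋐visited))) ρ⊨ψ restarts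
          (backchained-∷ʳ ρ Es Ei chained (isMinBasis-⊆ basis)) temp-anti (isMinBasis⇒antichain basis')
          (isMinBasis-∈⇒⋐ basis' ∘ ∈-++⁺ˡ) g∷W⋐temp
        where
        g∷W⋐temp : (g ∷ W) ⋐ temp
        g∷W⋐temp (here refl)     = lose g∈temp (⊑-refl g)
        g∷W⋐temp {w} (there w∈W) = above-⋐ w (W⋐visited w∈W) visited⋐temp

    -- The initial temp = ERR need not be an antichain; from the second iteration on, both lists are.
    loop-terminates-from-antichain : ∀ {ρ ψ Es visited temp} → eval ρ ψ ≡ true → Restarts ψ →
                                     Backchained ρ Es → Antichain temp →
                                     Terminates (mcLoop ρ ψ Es visited temp)
    loop-terminates-from-antichain {ρ} {Es = Es} ρ⊨ψ restarts chained temp-anti =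
      iteration-terminates ρ⊨ψ restarts chained λ {Ei} _ basis _ basis' →
        loop-terminates (AlmostFull⇒acc (AlmostFull-≡×≼ nA nB)) ρ⊨ψ restarts
          (backchained-∷ʳ ρ Es Ei chained (isMinBasis-⊆ basis))
          temp-anti (isMinBasis⇒antichain basis') (isMinBasis-∈⇒⋐ basis' ∘ ∈-++⁺ˡ) λ ()

    start-terminates : ∀ {ρ ψ} → eval ρ ψ ≡ true → Restarts ψ → Terminates (start ρ ψ)
    start-terminates {ρ} ρ⊨ψ restarts =
      iteration-terminates ρ⊨ψ restarts ([] , refl , _) λ {Ei} _ basis _ basis' →
        loop-terminates-from-antichain ρ⊨ψ restarts
          (backchained-∷ʳ ρ (ERR ∷ []) Ei ([] , refl , _) (isMinBasis-⊆ basis)) (isMinBasis⇒antichain basis')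

    repair-terminates : ∀ ρ ψ → eval ρ ψ ≡ true → Acc _<_ (models ψ) → Terminates (start ρ ψ)
    repair-terminates ρ ψ ρ⊨ψ (acc fewer) =
      start-terminates ρ⊨ψ λ ρ' ψ' ρ'⊨ψ' ψ'<ψ → repair-terminates ρ' ψ' ρ'⊨ψ' (fewer ψ'<ψ)

    paramRepair-terminates : Terminates paramRepairCall
    paramRepair-terminates = repair-terminates (λ _ → true) tt refl (<-wellFounded _)

theorem4 : (Tm : Templates) → Total Tm →
           let open Proc Tm in
           (ERR : List State) → (φ : Formula) →
           Run.Terminates ERR (TRConstr ∧' φ) (Run.paramRepairCall ERR (TRConstr ∧' φ))
theorem4 Tm _ ERR φ = Repair.Termination.paramRepair-terminates Tm ERR (Proc.TRConstr Tm Proc.∧' φ)
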